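{- Let $k,r$ be positive integers with $r\le k$. Then for every integer $h\ge\max\{r,2\}$ and every non-empty $k$-element set $A$ of integers, \[ |h^{(\geq r)}A| \ge h(k-1)-r(r-1)+1. \] Furthermore, suppose $|h^{(\geq r)}A| = h(k-1)-r(r-1)+1$ and that either (1) $h\ge r+2$ and $k\ge 2$, or (2) $h=r$ or $h=r+1$, and $k\ge 5$ and $2\le r\le k-2$. Then $A$ is an arithmetic progression.
   Context: For a finite non-empty set $A=\{a_1,\ldots,a_k\}$ of integers, a positive integer $r\le k$ and an integer $h\ge r$, define $h^{(\geq r)}A := \{ \sum_{i\in I} x_i a_i : I\subset\{1,\ldots,k\},\ |I|\ge r,\ x_i\ge 1 \text{ for all } i\in I,\ \sum_{i\in I}x_i = h\}$, i.e. the set of sums of $h$ elements of $A$ among which at least $r$ are distinct. -}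

module Defs where

open import Data.Nat as ℕ using (ℕ; zero; suc)
open import Data.Integer as ℤ using (ℤ; +_)
open import Data.Fin using (Fin; toℕ)
open import Data.Vec using (Vec; []; _∷_)
open import Data.List using (List; []; _∷_; map; concatMap; upTo; filter; length; deduplicate)
open import Data.Product using (Σ; ∃; _,_)
open import Function.Bundles using (_⇔_)
open import Relation.Binary.PropositionalEquality using (_≡_)
open import Relation.Nullary using (Dec)

compositions : (k h : ℕ) → List (Vec ℕ k)
compositions zero zero = [] ∷ []
compositions zero (suc h) = []
compositions (suc k) h =
  concatMap (λ i → map (i ∷_) (compositions k (h ℕ.∸ i))) (upTo (suc h))

support : ∀ {k} → Vec ℕ k → ℕ
support [] = zero
support (zero ∷ xs) = support xs
support (suc _ ∷ xs) = suc (support xs)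

weightedSum : ∀ {k} → Vec ℕ k → (Fin k → ℤ) → ℤ
weightedSum [] a = + 0
weightedSum (x ∷ xs) a = (+ x) ℤ.* a Fin.zero ℤ.+ weightedSum xs (λ i → a (Fin.suc i))
  where import Data.Fin as Fin

restrictedSumset : ∀ {k} → (h r : ℕ) → (Fin k → ℤ) → List ℤ
restrictedSumset {k} h r a =
  deduplicate ℤ._≟_
    (map (λ x → weightedSum x a)
         (filter (λ x → r ℕ.≤? support x) (compositions k h)))

sumsetSize : ∀ {k} → (h r : ℕ) → (Fin k → ℤ) → ℕ
sumsetSize h r a = length (restrictedSumset h r a)

IsAP : ∀ {k} → (Fin k → ℤ) → Set
IsAP {k} a = Σ ℤ λ c → Σ ℤ λ d →
  ∀ y → (∃ λ j → a j ≡ y) ⇔ (∃ λ (i : Fin k) → c ℤ.+ (+ toℕ i) ℤ.* d ≡ y)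

-- Sort A as b₀ < ⋯ < b_{k-1} and encode a sum by its multiplicity vector x ∈ ℕᵏ (mass h,
-- support ≥ r). Moving one unit one place to the right strictly increases the sum and raises the
-- moment Σ i xᵢ by one. From any admissible vector such moves, never dropping below support r,
-- lead down to moment r(r-1)/2 and up to moment h(k-1) - r(r-1)/2; the walk from bottom to top
-- gives h(k-1) - r(r-1) + 1 distinct sums. If two admissible vectors of equal moment had
-- different sums, the walk down from the smaller and the walk up from the larger would give one
-- sum more, so in the extremal case the sum depends only on the moment. Comparing w + eᵢ + eⱼ
-- with w + eₖ + eₗ for i + j = k + l then gives bᵢ + bⱼ = bₖ + bₗ whenever a suitable w exists,
-- and the hypotheses on h, r and k provide enough of these to force b₀ + b_{i+1} = b₁ + bᵢ.

module Submission where

open import Defs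
open import Data.Nat as ℕ using (ℕ; zero; suc; _+_; _*_; _∸_; _≤_; z≤n; s≤s)
import Data.Nat.Properties as ℕ
open import Data.Nat.Solver using (module +-*-Solver)
open import Data.Integer as ℤ using (ℤ; +_)
import Data.Integer.Properties as ℤ
open import Data.Integer.Solver renaming (module +-*-Solver to ℤ-Solver)
open import Data.Fin as Fin using (Fin; toℕ; inject₁)
open import Data.Fin.Patterns using (0F; 1F; 2F; 3F; 4F)
open import Data.Fin.Properties using (injective⇒≤; toℕ-inject₁)
import Data.Fin.Properties as Fin
open import Data.Fin.Permutation as Perm using (Permutation; _⟨$⟩ʳ_; _⟨$⟩ˡ_; _∘ₚ_; lift₀; transpose)
open import Data.Fin.Subset using (Subset; inside; outside; ⁅_⁆; _∪_; ∣_∣) renaming (_∈_ to _∈ₛ_)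
open import Data.Fin.Subset.Properties using (x∈⁅x⁆; p⊆p∪q; q⊆p∪q; ∣⁅x⁆∣≡1; ∣p∣≤∣x∷p∣)
open import Data.Vec as Vec using (Vec; []; _∷_; lookup; replicate; zipWith; here; there)
open import Data.Vec.Properties using (lookup∘tabulate; lookup-replicate)
import Data.Vec.Relation.Unary.All as VecAll
open import Data.List as List using (List; []; _∷_; length)
import Data.List.Properties as List
open import Data.List.Extrema ℤ.≤-totalOrder using (argmin; f[argmin]≤f[xs])
open import Data.List.Membership.Propositional using (_∈_)
open import Data.List.Membership.Propositional.Properties
  using (∈-lookup; ∈-allFin; ∈-concatMap⁺; ∈-map⁺; ∈-upTo⁺; ∈-filter⁺; ∈-deduplicate⁺)
open import Data.List.Membership.Setoid.Properties using (index-injective)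
open import Data.List.Relation.Binary.Subset.Propositional using (_⊆_)
import Data.List.Relation.Unary.Any as Any
open import Data.List.Relation.Unary.All as All using (All; []; _∷_)
import Data.List.Relation.Unary.All.Properties as All
open import Data.List.Relation.Unary.AllPairs as AllPairs using ([]; _∷_)
import Data.List.Relation.Unary.AllPairs.Properties as AllPairs
open import Data.List.Relation.Unary.Linked as Linked using (Linked; []; [-]; _∷_)
open import Data.List.Relation.Unary.Linked.Properties using (Linked⇒All; Linked⇒AllPairs)
  renaming (map⁺ to Linked-map⁺)
open import Data.List.Relation.Unary.Unique.Propositional using (Unique)
open import Data.Product using (∃-syntax; Σ-syntax; _,_; _×_; proj₁; proj₂)
open import Data.Sum using (_⊎_; inj₁; inj₂)
open import Algebra.Bundles using (AbelianGroup; CommutativeMonoid)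
open import Algebra.Properties.CommutativeSemigroup ℕ.+-commutativeSemigroup
  using () renaming (interchange to +-interchange)
open import Algebra.Properties.Group (AbelianGroup.group ℤ.+-0-abelianGroup) using (∙-cancelˡ; ∙-cancelʳ)
import Algebra.Properties.CommutativeMonoid.Sum as Sum
open import Function using (_∘_; flip)
open import Function.Bundles using (mk⇔)
open import Function.Definitions using (Injective)
open import Relation.Binary.Core using (_Preserves_⟶_)
open import Relation.Binary.PropositionalEquality
open import Relation.Nullary using (¬_; contradiction)

Unique⇒lookup-injective : ∀ {A : Set} {xs : List A} {i j} → Unique xs → List.lookup xs i ≡ List.lookup xs j → i ≡ j
Unique⇒lookup-injective {i = Fin.zero}  {Fin.zero}  (_   ∷ _) _  = refl
Unique⇒lookup-injective {i = Fin.zero}  {Fin.suc j} (x∉ ∷ _) eq = contradiction eq (All.lookup x∉ (∈-lookup j))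
Unique⇒lookup-injective {i = Fin.suc i} {Fin.zero}  (x∉ ∷ _) eq = contradiction (sym eq) (All.lookup x∉ (∈-lookup i))
Unique⇒lookup-injective {i = Fin.suc i} {Fin.suc j} (_   ∷ u) eq = cong Fin.suc (Unique⇒lookup-injective u eq)

unique-⊆⇒length≤ : ∀ {A : Set} {xs ys : List A} → Unique xs → xs ⊆ ys → length xs ≤ length ys
unique-⊆⇒length≤ {A} u xs⊆ys = injective⇒≤ λ eq →
  Unique⇒lookup-injective u (index-injective (setoid A) (xs⊆ys (∈-lookup _)) (xs⊆ys (∈-lookup _)) eq)

Linked<⇒Unique : ∀ {vs} → Linked ℤ._<_ vs → Unique vs
Linked<⇒Unique = AllPairs.map ℤ.<⇒≢ ∘ Linked⇒AllPairs ℤ.<-trans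

Linked>⇒Unique : ∀ {vs} → Linked ℤ._>_ vs → Unique vs
Linked>⇒Unique = AllPairs.map (λ v>w → ≢-sym (ℤ.<⇒≢ v>w)) ∘ Linked⇒AllPairs (flip ℤ.<-trans)

Linked>-++-Linked<⇒Unique : ∀ {v v′ vs ws} → v ℤ.< v′ → Linked ℤ._>_ (v ∷ vs) → Linked ℤ._<_ (v′ ∷ ws) →
  Unique ((v ∷ vs) List.++ (v′ ∷ ws))
Linked>-++-Linked<⇒Unique {v} {v′} {vs} {ws} v<v′ dec asc = AllPairs.++⁺ (Linked>⇒Unique dec) (Linked<⇒Unique asc)
  (All.map (λ x≤v → All.map (λ v′≤y → ℤ.<⇒≢ (ℤ.≤-<-trans x≤v (ℤ.<-≤-trans v<v′ v′≤y))) above) below)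
  where
  below : All (ℤ._≤ v) (v ∷ vs)
  below = Linked⇒All (flip ℤ.≤-trans) ℤ.≤-refl (Linked.map ℤ.<⇒≤ dec)
  above : All (v′ ℤ.≤_) (v′ ∷ ws)
  above = Linked⇒All ℤ.≤-trans ℤ.≤-refl (Linked.map ℤ.<⇒≤ asc)

mass : ∀ {n} → Vec ℕ n → ℕ
mass []       = 0
mass (x ∷ xs) = x + mass xs

-- Σ i xᵢ and Σ (n - 1 - i) xᵢ
moment comoment : ∀ {n} → Vec ℕ n → ℕ
moment []       = 0
moment (x ∷ xs) = mass xs + moment xs
comoment []               = 0
comoment {suc n} (x ∷ xs) = x * n + comoment xs

moment+comoment : ∀ {n} (x : Vec ℕ n) → moment x + comoment x ≡ mass x * (n ∸ 1)
moment+comoment []                = refl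
moment+comoment (x ∷ [])          = trans (cong (_+ 0) (ℕ.*-zeroʳ x)) (sym (ℕ.*-zeroʳ (x + 0)))
moment+comoment {suc (suc n)} (x ∷ xs@(_ ∷ _)) = begin
  mass xs + moment xs + (x * suc n + comoment xs)   ≡⟨ +-interchange (mass xs) (moment xs) (x * suc n) (comoment xs) ⟩
  mass xs + x * suc n + (moment xs + comoment xs)   ≡⟨ cong (_+_ (mass xs + x * suc n)) (moment+comoment xs) ⟩
  mass xs + x * suc n + mass xs * n                 ≡⟨ collect (mass xs) x n ⟩
  (x + mass xs) * suc n                             ∎
  where
  open ≡-Reasoning
  open +-*-Solver
  collect : ∀ m x n → m + x * suc n + m * n ≡ (x + m) * suc n
  collect = solve 3 (λ m x n → m :+ x :* (con 1 :+ n) :+ m :* n := (x :+ m) :* (con 1 :+ n)) refl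

triangle : ℕ → ℕ
triangle zero    = 0
triangle (suc n) = n + triangle n

triangle-double : ∀ n → triangle (suc n) + triangle (suc n) ≡ suc n * n
triangle-double zero    = refl
triangle-double (suc n) = begin
  (suc n + t) + (suc n + t)   ≡⟨ +-interchange (suc n) t (suc n) t ⟩
  suc n + suc n + (t + t)     ≡⟨ cong (_+_ (suc n + suc n)) (triangle-double n) ⟩
  suc n + suc n + suc n * n   ≡⟨ collect n ⟩
  suc (suc n) * suc n         ∎
  where
  t : ℕ
  t = triangle (suc n)
  open ≡-Reasoning
  open +-*-Solver
  collect : ∀ n → suc n + suc n + suc n * n ≡ suc (suc n) * suc n
  collect = solve 1 (λ n → (con 1 :+ n) :+ (con 1 :+ n) :+ (con 1 :+ n) :* n := (con 2 :+ n) :* (con 1 :+ n)) refl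

infix 4 _⋖_
data _⋖_ : ∀ {n} → Vec ℕ n → Vec ℕ n → Set where
  here  : ∀ {n p q} {xs : Vec ℕ n} → suc p ∷ q ∷ xs ⋖ p ∷ suc q ∷ xs
  there : ∀ {n z} {xs ys : Vec ℕ n} → xs ⋖ ys → z ∷ xs ⋖ z ∷ ys

⋖-mass : ∀ {n} {x y : Vec ℕ n} → x ⋖ y → mass x ≡ mass y
⋖-mass (here {p = p} {q} {xs}) = sym (ℕ.+-suc p (q + mass xs))
⋖-mass (there {z = z} x⋖y)     = cong (_+_ z) (⋖-mass x⋖y)

⋖-moment : ∀ {n} {x y : Vec ℕ n} → x ⋖ y → moment y ≡ suc (moment x)
⋖-moment here                            = refl
⋖-moment (there {xs = xs} {ys} x⋖y) = begin
  mass ys + moment ys         ≡⟨ cong₂ _+_ (sym (⋖-mass x⋖y)) (⋖-moment x⋖y) ⟩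
  mass xs + suc (moment xs)   ≡⟨ ℕ.+-suc (mass xs) (moment xs) ⟩
  suc (mass xs + moment xs)   ∎
  where open ≡-Reasoning

⋖-comoment : ∀ {n} {x y : Vec ℕ n} → x ⋖ y → comoment x ≡ suc (comoment y)
⋖-comoment {suc (suc n)} (here {p = p} {q} {xs}) = shift p q n (comoment xs)
  where
  open +-*-Solver
  shift : ∀ p q n c → suc p * suc n + (q * n + c) ≡ suc (p * suc n + (suc q * n + c))
  shift = solve 4 (λ p q n c → (con 1 :+ p) :* (con 1 :+ n) :+ (q :* n :+ c)
                             := con 1 :+ (p :* (con 1 :+ n) :+ ((con 1 :+ q) :* n :+ c))) refl
⋖-comoment {suc n} (there {z = z} {xs} {ys} x⋖y) = begin
  z * n + comoment xs         ≡⟨ cong (_+_ (z * n)) (⋖-comoment x⋖y) ⟩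
  z * n + suc (comoment ys)   ≡⟨ ℕ.+-suc (z * n) (comoment ys) ⟩
  suc (z * n + comoment ys)   ∎
  where open ≡-Reasoning

⋖-value : ∀ {n} {b : Fin n → ℤ} → b Preserves Fin._<_ ⟶ ℤ._<_ →
          ∀ {x y} → x ⋖ y → weightedSum x b ℤ.< weightedSum y b
⋖-value {b = b} b↑ (here {p = p} {q} {xs}) = begin-strict
  + suc p ℤ.* b 0F ℤ.+ (+ q ℤ.* b 1F ℤ.+ w)       ≡⟨ moveˡ (+ p) (+ q) (b 0F) (b 1F) w ⟩
  c ℤ.+ b 0F                                       <⟨ ℤ.+-monoʳ-< c (b↑ (s≤s z≤n)) ⟩
  c ℤ.+ b 1F                                       ≡⟨ moveʳ (+ p) (+ q) (b 0F) (b 1F) w ⟨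
  + p ℤ.* b 0F ℤ.+ (+ suc q ℤ.* b 1F ℤ.+ w)       ∎
  where
  open ℤ.≤-Reasoning
  open ℤ-Solver
  w c : ℤ
  w = weightedSum xs (b ∘ Fin.suc ∘ Fin.suc)
  c = + p ℤ.* b 0F ℤ.+ (+ q ℤ.* b 1F ℤ.+ w)
  moveˡ : ∀ P Q B₀ B₁ W → (+ 1 ℤ.+ P) ℤ.* B₀ ℤ.+ (Q ℤ.* B₁ ℤ.+ W) ≡ P ℤ.* B₀ ℤ.+ (Q ℤ.* B₁ ℤ.+ W) ℤ.+ B₀
  moveʳ : ∀ P Q B₀ B₁ W → P ℤ.* B₀ ℤ.+ ((+ 1 ℤ.+ Q) ℤ.* B₁ ℤ.+ W) ≡ P ℤ.* B₀ ℤ.+ (Q ℤ.* B₁ ℤ.+ W) ℤ.+ B₁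
  moveˡ = solve 5 (λ P Q B₀ B₁ W → (con (+ 1) :+ P) :* B₀ :+ (Q :* B₁ :+ W) := P :* B₀ :+ (Q :* B₁ :+ W) :+ B₀) refl
  moveʳ = solve 5 (λ P Q B₀ B₁ W → P :* B₀ :+ ((con (+ 1) :+ Q) :* B₁ :+ W) := P :* B₀ :+ (Q :* B₁ :+ W) :+ B₁) refl
⋖-value {b = b} b↑ (there {z = z} x⋖y) =
  ℤ.+-monoʳ-< (+ z ℤ.* b 0F) (⋖-value (b↑ ∘ s≤s) x⋖y)

Zeros : ∀ {n} → Vec ℕ n → Set
Zeros = VecAll.All (_≡ 0)

data Ones : ∀ {n} → Vec ℕ n → Set where
  zeros : ∀ {n} {xs : Vec ℕ n} → Zeros xs → Ones xs
  1∷_   : ∀ {n} {xs : Vec ℕ n} → Ones xs → Ones (1 ∷ xs)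

data Bottom : ∀ {n} → Vec ℕ n → Set where
  zeros : ∀ {n} {xs : Vec ℕ n} → Zeros xs → Bottom xs
  _∷_   : ∀ {n} m {xs : Vec ℕ n} → Ones xs → Bottom (suc m ∷ xs)

data Rise : ∀ {n} → Vec ℕ n → Set where
  last : ∀ m → Rise (suc m ∷ [])
  1∷_  : ∀ {n} {xs : Vec ℕ n} → Rise xs → Rise (1 ∷ xs)

data Top : ∀ {n} → Vec ℕ n → Set where
  []   : Top []
  rise : ∀ {n} {xs : Vec ℕ n} → Rise xs → Top xs
  0∷_  : ∀ {n} {xs : Vec ℕ n} → Top xs → Top (0 ∷ xs)

Zeros-support : ∀ {n} {xs : Vec ℕ n} → Zeros xs → support xs ≡ 0
Zeros-support VecAll.[]         = refl
Zeros-support (refl VecAll.∷ z) = Zeros-support z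

Zeros-mass : ∀ {n} {xs : Vec ℕ n} → Zeros xs → mass xs ≡ 0
Zeros-mass VecAll.[]         = refl
Zeros-mass (refl VecAll.∷ z) = Zeros-mass z

Zeros-moment : ∀ {n} {xs : Vec ℕ n} → Zeros xs → moment xs ≡ 0
Zeros-moment VecAll.[]         = refl
Zeros-moment (refl VecAll.∷ z) = cong₂ _+_ (Zeros-mass z) (Zeros-moment z)

replicate-Zeros : ∀ n → Zeros (replicate n 0)
replicate-Zeros zero    = VecAll.[]
replicate-Zeros (suc n) = refl VecAll.∷ replicate-Zeros n

Ones-mass : ∀ {n} {xs : Vec ℕ n} → Ones xs → mass xs ≡ support xs
Ones-mass (zeros z) = trans (Zeros-mass z) (sym (Zeros-support z))
Ones-mass (1∷ o)    = cong suc (Ones-mass o)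

Ones-moment : ∀ {n} {xs : Vec ℕ n} → Ones xs → moment xs ≡ triangle (support xs)
Ones-moment (zeros z) = trans (Zeros-moment z) (cong triangle (sym (Zeros-support z)))
Ones-moment (1∷ o)    = cong₂ _+_ (Ones-mass o) (Ones-moment o)

Bottom-moment : ∀ {n} {x : Vec ℕ n} → Bottom x → moment x ≡ triangle (support x)
Bottom-moment (zeros z) = Ones-moment (zeros z)
Bottom-moment (_ ∷ o)   = cong₂ _+_ (Ones-mass o) (Ones-moment o)

Rise-support : ∀ {n} {xs : Vec ℕ n} → Rise xs → support xs ≡ n
Rise-support (last _) = refl
Rise-support (1∷ r)   = cong suc (Rise-support r)

Top-comoment : ∀ {n} {x : Vec ℕ n} → Top x → comoment x ≡ triangle (support x)
Top-comoment []       = refl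
Top-comoment (rise r) = trans (Rise-comoment r) (cong triangle (sym (Rise-support r)))
  where
  Rise-comoment : ∀ {n} {xs : Vec ℕ n} → Rise xs → comoment xs ≡ triangle n
  Rise-comoment (last m)       = cong (_+ 0) (ℕ.*-zeroʳ m)
  Rise-comoment {suc n} (1∷ r) = cong₂ _+_ (ℕ.+-identityʳ n) (Rise-comoment r)
Top-comoment (0∷ t)   = Top-comoment t

support-∷-mono : ∀ {n} z {xs ys : Vec ℕ n} → support xs ≤ support ys → support (z ∷ xs) ≤ support (z ∷ ys)
support-∷-mono zero    le = le
support-∷-mono (suc _) le = s≤s le

lower-or-Bottom : ∀ {n} (x : Vec ℕ n) → (∃[ y ] y ⋖ x × support x ≤ support y) ⊎ Bottom x
lower-or-Bottom [] = inj₂ (zeros VecAll.[])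
lower-or-Bottom (x₀ ∷ xs) with lower-or-Bottom xs
... | inj₁ (y , y⋖xs , le) = inj₁ (x₀ ∷ y , there y⋖xs , support-∷-mono x₀ le)
lower-or-Bottom (zero  ∷ xs) | inj₂ (zeros z) = inj₂ (zeros (refl VecAll.∷ z))
lower-or-Bottom (suc m ∷ xs) | inj₂ (zeros z) = inj₂ (m ∷ zeros z)
lower-or-Bottom (zero   ∷ suc zero ∷ xs)    | inj₂ (_ ∷ _) = inj₁ (1 ∷ 0 ∷ xs , here , ℕ.≤-refl)
lower-or-Bottom (suc m  ∷ suc zero ∷ xs)    | inj₂ (_ ∷ o) = inj₂ (m ∷ 1∷ o)
lower-or-Bottom (zero   ∷ suc (suc q) ∷ xs) | inj₂ (_ ∷ _) = inj₁ (1 ∷ suc q ∷ xs , here , ℕ.n≤1+n _)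
lower-or-Bottom (suc m  ∷ suc (suc q) ∷ xs) | inj₂ (_ ∷ _) = inj₁ (suc (suc m) ∷ suc q ∷ xs , here , ℕ.≤-refl)

Bottom-lower : ∀ {n} {x : Vec ℕ n} → Bottom x → 2 ≤ support x → ∃[ y ] y ⋖ x × support x ≤ suc (support y)
Bottom-lower (zeros z)     2≤s       = contradiction (subst (2 ≤_) (Zeros-support z) 2≤s) λ ()
Bottom-lower (_ ∷ zeros z) (s≤s 1≤s) = contradiction (subst (1 ≤_) (Zeros-support z) 1≤s) λ ()
Bottom-lower {x = suc m ∷ 1 ∷ xs} (_ ∷ 1∷ _) _ = suc (suc m) ∷ 0 ∷ xs , here , ℕ.≤-refl

raise-or-Top : ∀ {n} (x : Vec ℕ n) → (∃[ y ] x ⋖ y × support x ≤ support y) ⊎ Top x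
raise-or-Top [] = inj₂ []
raise-or-Top (x₀ ∷ xs) with raise-or-Top xs
... | inj₁ (y , xs⋖y , le) = inj₁ (x₀ ∷ y , there xs⋖y , support-∷-mono x₀ le)
raise-or-Top (zero  ∷ xs)         | inj₂ t = inj₂ (0∷ t)
raise-or-Top (suc m ∷ [])         | inj₂ _ = inj₂ (rise (last m))
raise-or-Top (suc zero ∷ zero ∷ xs)    | inj₂ _ = inj₁ (0 ∷ 1 ∷ xs , here , ℕ.≤-refl)
raise-or-Top (suc (suc m) ∷ zero ∷ xs) | inj₂ _ = inj₁ (suc m ∷ 1 ∷ xs , here , ℕ.n≤1+n _)
raise-or-Top (suc zero ∷ suc q ∷ xs)     | inj₂ (rise r) = inj₂ (rise (1∷ r))
raise-or-Top (suc (suc m) ∷ suc q ∷ xs) | inj₂ (rise _) = inj₁ (suc m ∷ suc (suc q) ∷ xs , here , ℕ.≤-refl)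

Top-raise : ∀ {n} {x : Vec ℕ n} → Top x → 2 ≤ support x → ∃[ y ] x ⋖ y × support x ≤ suc (support y)
Top-raise (rise (1∷ last m))                  _ = 0 ∷ suc (suc m) ∷ [] , here , ℕ.≤-refl
Top-raise {x = 1 ∷ 1 ∷ xs} (rise (1∷ 1∷ _))   _ = 0 ∷ 2 ∷ xs , here , ℕ.≤-refl
Top-raise (rise (last _)) (s≤s ())
Top-raise (0∷ t) 2≤s with y , x⋖y , le ← Top-raise t 2≤s = 0 ∷ y , there x⋖y , le

step-or-extremal : ∀ {n} {R : Vec ℕ n → Vec ℕ n → Set} {E : Vec ℕ n → Set} {μ : Vec ℕ n → ℕ} →
  (∀ x → (∃[ y ] R x y × support x ≤ support y) ⊎ E x) →
  (∀ {x} → E x → μ x ≡ triangle (support x)) →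
  (∀ {x} → E x → 2 ≤ support x → ∃[ y ] R x y × support x ≤ suc (support y)) →
  ∀ {r x} → 1 ≤ r → r ≤ support x → μ x ≡ triangle r ⊎ ∃[ y ] R x y × r ≤ support y
step-or-extremal classify μ-extremal leave {x = x} 1≤r r≤s with classify x
... | inj₁ (y , xRy , s≤s′) = inj₂ (y , xRy , ℕ.≤-trans r≤s s≤s′)
... | inj₂ e with ℕ.m≤n⇒m<n∨m≡n r≤s
...   | inj₂ r≡s = inj₁ (trans (μ-extremal e) (cong triangle (sym r≡s)))
...   | inj₁ r<s with y , xRy , s≤1+s′ ← leave e (ℕ.≤-trans (s≤s 1≤r) r<s) =
          inj₂ (y , xRy , ℕ.s≤s⁻¹ (ℕ.≤-trans r<s s≤1+s′))

module _ {X : Set} (_▷_ : X → X → Set) (μ : X → ℕ) (μ-▷ : ∀ {x y} → x ▷ y → μ x ≡ suc (μ y))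
         (P : X → Set) (base : ℕ) (step : ∀ {x} → P x → μ x ≡ base ⊎ ∃[ y ] x ▷ y × P y) where

  Descent : X → Set
  Descent x = ∃[ ys ] Linked _▷_ (x ∷ ys) × All P (x ∷ ys) × length ys + base ≡ μ x

  private
    descent-from : ∀ m {x} → μ x ≡ m → P x → Descent x
    descent-from m μx≡m px with step px
    ... | inj₁ μx≡base = [] , [-] , px ∷ [] , sym μx≡base
    descent-from zero    μx≡0 px | inj₂ (y , x▷y , py) = contradiction (trans (sym μx≡0) (μ-▷ x▷y)) λ ()
    descent-from (suc m) μx≡m px | inj₂ (y , x▷y , py)
      with ys , linked , all , len ← descent-from m (ℕ.suc-injective (trans (sym (μ-▷ x▷y)) μx≡m)) py
      = y ∷ ys , x▷y ∷ linked , px ∷ all , trans (cong suc len) (sym (μ-▷ x▷y))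

  descent : ∀ {x} → P x → Descent x
  descent {x} = descent-from (μ x) refl

record Admissible {n} (h r : ℕ) (x : Vec ℕ n) : Set where
  constructor admissible
  field
    mass≡    : mass x ≡ h
    support≥ : r ≤ support x

∈-compositions : ∀ {k} (x : Vec ℕ k) → x ∈ compositions k (mass x)
∈-compositions [] = Any.here refl
∈-compositions {suc k} (x ∷ xs) =
  ∈-concatMap⁺ (λ i → List.map (i ∷_) (compositions k (x + mass xs ∸ i)))
    (Any.map (λ { refl → ∈-map⁺ (x ∷_) (subst (λ t → xs ∈ compositions k t)
                                             (sym (ℕ.m+n∸m≡n x (mass xs))) (∈-compositions xs)) })
             (∈-upTo⁺ (s≤s (ℕ.m≤m+n x (mass xs)))))

∈-restrictedSumset : ∀ {k h r} (a : Fin k → ℤ) {x} → Admissible h r x → weightedSum x a ∈ restrictedSumset h r a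
∈-restrictedSumset a {x} (admissible refl r≤s) =
  ∈-deduplicate⁺ ℤ._≟_ (∈-map⁺ (λ y → weightedSum y a)
    (∈-filter⁺ (λ y → _ ℕ.≤? support y) (∈-compositions x) r≤s))

permute : ∀ {k} → Permutation k k → Vec ℕ k → Vec ℕ k
permute σ x = Vec.tabulate (λ j → lookup x (σ ⟨$⟩ˡ j))

module _ {c ℓ} (M : CommutativeMonoid c ℓ) {k} (σ : Permutation k k) (x : Vec ℕ k) where
  open CommutativeMonoid M using (Carrier; _≈_) renaming (trans to ≈-trans; reflexive to ≈-reflexive)
  open Sum M using (sum; sum-permute; sum-cong-≗)

  sum-permute-entries : (F : Fin k → ℕ → Carrier) →
    sum (λ j → F j (lookup (permute σ x) j)) ≈ sum (λ i → F (σ ⟨$⟩ʳ i) (lookup x i))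
  sum-permute-entries F = ≈-trans (≈-reflexive (sum-cong-≗ λ j → cong (F j) (lookup∘tabulate _ j)))
    (≈-trans (sum-permute (λ j → F j (lookup x (σ ⟨$⟩ˡ j))) σ)
      (≈-reflexive (sum-cong-≗ λ i → cong (λ t → F (σ ⟨$⟩ʳ i) (lookup x t)) (Perm.inverseˡ σ))))

module ΣN = Sum ℕ.+-0-commutativeMonoid
module ΣZ = Sum ℤ.+-0-commutativeMonoid

mass-sum : ∀ {k} (x : Vec ℕ k) → mass x ≡ ΣN.sum (lookup x)
mass-sum []       = refl
mass-sum (x ∷ xs) = cong (_+_ x) (mass-sum xs)

support-sum : ∀ {k} (x : Vec ℕ k) → support x ≡ ΣN.sum (λ i → support (lookup x i ∷ []))
support-sum []           = refl
support-sum (zero  ∷ xs) = support-sum xs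
support-sum (suc _ ∷ xs) = cong suc (support-sum xs)

weightedSum-sum : ∀ {k} (x : Vec ℕ k) (a : Fin k → ℤ) → weightedSum x a ≡ ΣZ.sum (λ i → + lookup x i ℤ.* a i)
weightedSum-sum []       a = refl
weightedSum-sum (x ∷ xs) a = cong (ℤ._+_ (+ x ℤ.* a 0F)) (weightedSum-sum xs (a ∘ Fin.suc))

module _ {k} (σ : Permutation k k) (x : Vec ℕ k) where

  mass-permute : mass (permute σ x) ≡ mass x
  mass-permute = trans (mass-sum (permute σ x))
    (trans (sum-permute-entries ℕ.+-0-commutativeMonoid σ x (λ _ v → v)) (sym (mass-sum x)))

  support-permute : support (permute σ x) ≡ support x
  support-permute = trans (support-sum (permute σ x))
    (trans (sum-permute-entries ℕ.+-0-commutativeMonoid σ x (λ _ v → support (v ∷ []))) (sym (support-sum x)))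

  weightedSum-permute : ∀ a → weightedSum (permute σ x) a ≡ weightedSum x (a ∘ (σ ⟨$⟩ʳ_))
  weightedSum-permute a = trans (weightedSum-sum (permute σ x) a)
    (trans (sum-permute-entries ℤ.+-0-commutativeMonoid σ x (λ j v → + v ℤ.* a j)) (sym (weightedSum-sum x _)))

∈-restrictedSumset-permute : ∀ {k h r} (a : Fin k → ℤ) (σ : Permutation k k) {x} → Admissible h r x →
  weightedSum x (a ∘ (σ ⟨$⟩ʳ_)) ∈ restrictedSumset h r a
∈-restrictedSumset-permute a σ {x} (admissible mass≡h r≤s) = subst (_∈ restrictedSumset _ _ a) (weightedSum-permute σ x a)
  (∈-restrictedSumset a {permute σ x}
    (admissible (trans (mass-permute σ x) mass≡h) (subst (_ ≤_) (sym (support-permute σ x)) r≤s)))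

increasing-rearrangement : ∀ {k} (a : Fin k → ℤ) → Injective _≡_ _≡_ a →
  Σ[ σ ∈ Permutation k k ] (a ∘ (σ ⟨$⟩ʳ_)) Preserves Fin._<_ ⟶ ℤ._<_
increasing-rearrangement {zero}  a _ = Perm.id , λ { {()} }
increasing-rearrangement {suc k} a a-inj = lift₀ σ ∘ₚ τ , increasing
  where
  τ : Permutation (suc k) (suc k)
  τ = transpose 0F (argmin a 0F (List.allFin (suc k)))
  τ-injective : ∀ {i j} → τ ⟨$⟩ʳ i ≡ τ ⟨$⟩ʳ j → i ≡ j
  τ-injective eq = trans (sym (Perm.inverseˡ τ)) (trans (cong (τ ⟨$⟩ˡ_) eq) (Perm.inverseˡ τ))
  minimal : ∀ j → a (τ ⟨$⟩ʳ 0F) ℤ.≤ a j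
  minimal j = All.lookup (f[argmin]≤f[xs] {f = a} 0F (List.allFin (suc k))) (∈-allFin j)
  rest : Σ[ σ ∈ Permutation k k ] (a ∘ (τ ⟨$⟩ʳ_) ∘ Fin.suc ∘ (σ ⟨$⟩ʳ_)) Preserves Fin._<_ ⟶ ℤ._<_
  rest = increasing-rearrangement (a ∘ (τ ⟨$⟩ʳ_) ∘ Fin.suc) (Fin.suc-injective ∘ τ-injective ∘ a-inj)
  σ : Permutation k k
  σ = proj₁ rest
  increasing : (a ∘ ((lift₀ σ ∘ₚ τ) ⟨$⟩ʳ_)) Preserves Fin._<_ ⟶ ℤ._<_
  increasing {Fin.zero}  {Fin.suc j} _   =
    ℤ.≤∧≢⇒< (minimal _) (λ eq → contradiction (τ-injective {0F} {Fin.suc (σ ⟨$⟩ʳ j)} (a-inj eq)) λ ())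
  increasing {Fin.suc i} {Fin.suc j} i<j = proj₂ rest (ℕ.s<s⁻¹ i<j)

ones : ∀ {n} s → s ≤ n → Vec ℕ n
ones zero    _         = replicate _ 0
ones (suc s) (s≤s s≤n) = 1 ∷ ones s s≤n

ones-Ones : ∀ {n} s (s≤n : s ≤ n) → Ones (ones s s≤n)
ones-Ones zero    _         = zeros (replicate-Zeros _)
ones-Ones (suc s) (s≤s s≤n) = 1∷ ones-Ones s s≤n

ones-support : ∀ {n} s (s≤n : s ≤ n) → support (ones s s≤n) ≡ s
ones-support {n} zero _        = Zeros-support (replicate-Zeros n)
ones-support (suc s) (s≤s s≤n) = cong suc (ones-support s s≤n)

bottom-vector : ∀ {n} s t → s ≤ n → suc s ≤ t → ∃[ x ] Admissible {suc n} t (suc s) x × moment x ≡ triangle (suc s)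
bottom-vector {n} s t s≤n 1+s≤t =
  x , admissible mass≡t (ℕ.≤-reflexive (sym support≡)) , trans (Bottom-moment bottom) (cong triangle support≡)
  where
  x : Vec ℕ (suc n)
  x = suc (t ∸ suc s) ∷ ones s s≤n
  bottom : Bottom x
  bottom = _ ∷ ones-Ones s s≤n
  support≡ : support x ≡ suc s
  support≡ = cong suc (ones-support s s≤n)
  mass≡t : mass x ≡ t
  mass≡t = begin
    suc (t ∸ suc s) + mass (ones s s≤n)
      ≡⟨ cong (_+_ (suc (t ∸ suc s))) (trans (Ones-mass (ones-Ones s s≤n)) (ones-support s s≤n)) ⟩
    suc (t ∸ suc s) + s                   ≡⟨ ℕ.+-suc (t ∸ suc s) s ⟨
    t ∸ suc s + suc s                     ≡⟨ ℕ.m∸n+n≡m 1+s≤t ⟩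
    t                                     ∎
    where open ≡-Reasoning

module Chains {n} {b : Fin n → ℤ} (b↑ : b Preserves Fin._<_ ⟶ ℤ._<_) {h r} (1≤r : 1 ≤ r)
              (S : List ℤ) (∈S : ∀ {x} → Admissible h r x → weightedSum x b ∈ S) where

  private
    value : Vec ℕ n → ℤ
    value x = weightedSum x b

    t : ℕ
    t = triangle r

    step-down : ∀ {x : Vec ℕ n} → Admissible h r x → moment x ≡ t ⊎ ∃[ y ] y ⋖ x × Admissible h r y
    step-down {x} (admissible mass≡h r≤s) with step-or-extremal lower-or-Bottom Bottom-moment Bottom-lower {x = x} 1≤r r≤s
    ... | inj₁ moment≡t          = inj₁ moment≡t
    ... | inj₂ (y , y⋖x , r≤s′) = inj₂ (y , y⋖x , admissible (trans (⋖-mass y⋖x) mass≡h) r≤s′)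

    step-up : ∀ {x : Vec ℕ n} → Admissible h r x → comoment x ≡ t ⊎ ∃[ y ] x ⋖ y × Admissible h r y
    step-up {x} (admissible mass≡h r≤s) with step-or-extremal raise-or-Top Top-comoment Top-raise {x = x} 1≤r r≤s
    ... | inj₁ comoment≡t        = inj₁ comoment≡t
    ... | inj₂ (y , x⋖y , r≤s′) = inj₂ (y , x⋖y , admissible (trans (sym (⋖-mass x⋖y)) mass≡h) r≤s′)

    descend : ∀ {x : Vec ℕ n} → Admissible h r x →
      ∃[ ys ] Linked (flip _⋖_) (x ∷ ys) × All (Admissible h r) (x ∷ ys) × length ys + t ≡ moment x
    descend = descent (flip _⋖_) moment ⋖-moment (Admissible h r) t step-down

    ascend : ∀ {x : Vec ℕ n} → Admissible h r x →
      ∃[ ys ] Linked _⋖_ (x ∷ ys) × All (Admissible h r) (x ∷ ys) × length ys + t ≡ comoment x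
    ascend = descent _⋖_ comoment ⋖-comoment (Admissible h r) t step-up

    values∈S : ∀ {xs : List (Vec ℕ n)} → All (Admissible h r) xs → All (_∈ S) (List.map value xs)
    values∈S adm = All.map⁺ (All.map ∈S adm)

  chain-across-levels : ∀ {x : Vec ℕ n} → Admissible h r x → moment x ≡ t → suc (h * (n ∸ 1)) ≤ length S + (t + t)
  chain-across-levels {x} adm@(admissible mass≡h _) moment≡t
    with us , linked , all , len ← ascend {x} adm = subst (_≤ length S + (t + t)) (sym count) bounded
    where
    vs : List ℤ
    vs = List.map value (x ∷ us)
    bounded : length vs + (t + t) ≤ length S + (t + t)
    bounded = ℕ.+-monoˡ-≤ (t + t) (unique-⊆⇒length≤
      (Linked<⇒Unique (Linked-map⁺ (Linked.map (⋖-value b↑) linked))) (All.lookup (values∈S all)))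
    count : suc (h * (n ∸ 1)) ≡ length vs + (t + t)
    count = begin
      suc (h * (n ∸ 1))                 ≡⟨ cong (λ m → suc (m * (n ∸ 1))) mass≡h ⟨
      suc (mass x * (n ∸ 1))            ≡⟨ cong suc (moment+comoment x) ⟨
      suc (moment x + comoment x)       ≡⟨ cong₂ (λ p q → suc (p + q)) moment≡t (sym len) ⟩
      suc (t + (length us + t))         ≡⟨ regroup t (length us) ⟩
      suc (length us) + (t + t)         ≡⟨ cong (λ m → suc m + (t + t)) (List.length-map value us) ⟨
      length vs + (t + t)               ∎
      where
      open ≡-Reasoning
      open +-*-Solver
      regroup : ∀ t l → suc (t + (l + t)) ≡ suc l + (t + t)
      regroup = solve 2 (λ t l → con 1 :+ (t :+ (l :+ t)) := con 1 :+ l :+ (t :+ t)) refl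

  split-level : ∀ {u u′ : Vec ℕ n} → Admissible h r u → Admissible h r u′ → moment u ≡ moment u′ →
    weightedSum u b ℤ.< weightedSum u′ b → suc (suc (h * (n ∸ 1))) ≤ length S + (t + t)
  split-level {u} {u′} adm adm′@(admissible mass≡h _) same-level u<u′
    with ds , linked↓ , all↓ , len↓ ← descend {u} adm
       | us , linked↑ , all↑ , len↑ ← ascend {u′} adm′ = subst (_≤ length S + (t + t)) (sym count) bounded
    where
    vs↓ vs↑ : List ℤ
    vs↓ = List.map value (u ∷ ds)
    vs↑ = List.map value (u′ ∷ us)
    bounded : length (vs↓ List.++ vs↑) + (t + t) ≤ length S + (t + t)
    bounded = ℕ.+-monoˡ-≤ (t + t) (unique-⊆⇒length≤
      (Linked>-++-Linked<⇒Unique u<u′ (Linked-map⁺ (Linked.map (⋖-value b↑) linked↓))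
                                          (Linked-map⁺ (Linked.map (⋖-value b↑) linked↑)))
      (All.lookup (All.++⁺ (values∈S all↓) (values∈S all↑))))
    count : suc (suc (h * (n ∸ 1))) ≡ length (vs↓ List.++ vs↑) + (t + t)
    count = begin
      suc (suc (h * (n ∸ 1)))                            ≡⟨ cong (λ m → suc (suc (m * (n ∸ 1)))) mass≡h ⟨
      suc (suc (mass u′ * (n ∸ 1)))                      ≡⟨ cong (suc ∘ suc) (moment+comoment u′) ⟨
      suc (suc (moment u′ + comoment u′))
        ≡⟨ cong₂ (λ p q → suc (suc (p + q))) (trans (sym same-level) (sym len↓)) (sym len↑) ⟩
      suc (suc ((length ds + t) + (length us + t)))      ≡⟨ regroup (length ds) (length us) t ⟩
      (suc (length ds) + suc (length us)) + (t + t)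
        ≡⟨ cong₂ (λ p q → (suc p + suc q) + (t + t)) (List.length-map value ds) (List.length-map value us) ⟨
      (length vs↓ + length vs↑) + (t + t)                ≡⟨ cong (_+ (t + t)) (List.length-++ vs↓) ⟨
      length (vs↓ List.++ vs↑) + (t + t)                 ∎
      where
      open ≡-Reasoning
      open +-*-Solver
      regroup : ∀ a b t → suc (suc ((a + t) + (b + t))) ≡ (suc a + suc b) + (t + t)
      regroup = solve 3 (λ a b t → con 2 :+ ((a :+ t) :+ (b :+ t)) := (con 1 :+ a :+ (con 1 :+ b)) :+ (t :+ t)) refl

infixl 6 _⊕_
_⊕_ : ∀ {n} → Vec ℕ n → Vec ℕ n → Vec ℕ n
_⊕_ = zipWith _+_

unit : ∀ {n} → Fin n → Vec ℕ n
unit Fin.zero    = 1 ∷ replicate _ 0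
unit (Fin.suc i) = 0 ∷ unit i

mass-⊕ : ∀ {n} (x y : Vec ℕ n) → mass (x ⊕ y) ≡ mass x + mass y
mass-⊕ []       []       = refl
mass-⊕ (x ∷ xs) (y ∷ ys) = trans (cong (_+_ (x + y)) (mass-⊕ xs ys)) (+-interchange x y (mass xs) (mass ys))

moment-⊕ : ∀ {n} (x y : Vec ℕ n) → moment (x ⊕ y) ≡ moment x + moment y
moment-⊕ []       []       = refl
moment-⊕ (x ∷ xs) (y ∷ ys) =
  trans (cong₂ _+_ (mass-⊕ xs ys) (moment-⊕ xs ys)) (+-interchange (mass xs) (mass ys) (moment xs) (moment ys))

weightedSum-⊕ : ∀ {n} (x y : Vec ℕ n) (b : Fin n → ℤ) → weightedSum (x ⊕ y) b ≡ weightedSum x b ℤ.+ weightedSum y b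
weightedSum-⊕ []       []       b = refl
weightedSum-⊕ (x ∷ xs) (y ∷ ys) b = begin
  + (x + y) ℤ.* b 0F ℤ.+ weightedSum (xs ⊕ ys) (b ∘ Fin.suc)
    ≡⟨ cong₂ (λ p q → p ℤ.* b 0F ℤ.+ q) (ℤ.pos-+ x y) (weightedSum-⊕ xs ys (b ∘ Fin.suc)) ⟩
  (+ x ℤ.+ + y) ℤ.* b 0F ℤ.+ (weightedSum xs (b ∘ Fin.suc) ℤ.+ weightedSum ys (b ∘ Fin.suc))
    ≡⟨ distribute (+ x) (+ y) (b 0F) _ _ ⟩
  (+ x ℤ.* b 0F ℤ.+ weightedSum xs (b ∘ Fin.suc)) ℤ.+ (+ y ℤ.* b 0F ℤ.+ weightedSum ys (b ∘ Fin.suc)) ∎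
  where
  open ≡-Reasoning
  open ℤ-Solver
  distribute : ∀ X Y B U V → (X ℤ.+ Y) ℤ.* B ℤ.+ (U ℤ.+ V) ≡ (X ℤ.* B ℤ.+ U) ℤ.+ (Y ℤ.* B ℤ.+ V)
  distribute = solve 5 (λ X Y B U V → (X :+ Y) :* B :+ (U :+ V) := (X :* B :+ U) :+ (Y :* B :+ V)) refl

mass-unit : ∀ {n} (i : Fin n) → mass (unit i) ≡ 1
mass-unit {suc n} Fin.zero = cong suc (Zeros-mass (replicate-Zeros n))
mass-unit (Fin.suc i)      = mass-unit i

moment-unit : ∀ {n} (i : Fin n) → moment (unit i) ≡ toℕ i
moment-unit {suc n} Fin.zero = cong₂ _+_ (Zeros-mass (replicate-Zeros n)) (Zeros-moment (replicate-Zeros n))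
moment-unit (Fin.suc i)      = cong₂ _+_ (mass-unit i) (moment-unit i)

weightedSum-Zeros : ∀ {n} {xs : Vec ℕ n} (b : Fin n → ℤ) → Zeros xs → weightedSum xs b ≡ + 0
weightedSum-Zeros b VecAll.[]         = refl
weightedSum-Zeros b (refl VecAll.∷ z) = trans (ℤ.+-identityˡ _) (weightedSum-Zeros (b ∘ Fin.suc) z)

weightedSum-unit : ∀ {n} (i : Fin n) (b : Fin n → ℤ) → weightedSum (unit i) b ≡ b i
weightedSum-unit {suc n} Fin.zero b = begin
  + 1 ℤ.* b 0F ℤ.+ weightedSum (replicate n 0) (b ∘ Fin.suc)
    ≡⟨ cong₂ ℤ._+_ (ℤ.*-identityˡ (b 0F)) (weightedSum-Zeros _ (replicate-Zeros n)) ⟩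
  b 0F ℤ.+ + 0                                                 ≡⟨ ℤ.+-identityʳ (b 0F) ⟩
  b 0F                                                         ∎
  where open ≡-Reasoning
weightedSum-unit (Fin.suc i) b = trans (ℤ.+-identityˡ _) (weightedSum-unit i (b ∘ Fin.suc))

support-⊕ˡ : ∀ {n} (x y : Vec ℕ n) → support x ≤ support (x ⊕ y)
support-⊕ˡ []           []           = z≤n
support-⊕ˡ (zero  ∷ xs) (zero  ∷ ys) = support-⊕ˡ xs ys
support-⊕ˡ (zero  ∷ xs) (suc _ ∷ ys) = ℕ.m≤n⇒m≤1+n (support-⊕ˡ xs ys)
support-⊕ˡ (suc _ ∷ xs) (_     ∷ ys) = s≤s (support-⊕ˡ xs ys)

⊕-identityʳ : ∀ {n} (x : Vec ℕ n) → x ⊕ replicate n 0 ≡ x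
⊕-identityʳ []       = refl
⊕-identityʳ (x ∷ xs) = cong₂ _∷_ (ℕ.+-identityʳ x) (⊕-identityʳ xs)

support-⊕-unit : ∀ {n} (x : Vec ℕ n) (i : Fin n) → lookup x i ≡ 0 → support (x ⊕ unit i) ≡ suc (support x)
support-⊕-unit (.0 ∷ xs) Fin.zero refl = cong (suc ∘ support) (⊕-identityʳ xs)
support-⊕-unit (zero  ∷ xs) (Fin.suc i) xᵢ≡0 = support-⊕-unit xs i xᵢ≡0
support-⊕-unit (suc _ ∷ xs) (Fin.suc i) xᵢ≡0 = cong suc (support-⊕-unit xs i xᵢ≡0)

lookup-⊕-unit : ∀ {n} (x : Vec ℕ n) {i j : Fin n} → i ≢ j → lookup (x ⊕ unit i) j ≡ lookup x j
lookup-⊕-unit (_ ∷ _)  {Fin.zero}  {Fin.zero}  i≢j = contradiction refl i≢j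
lookup-⊕-unit (_ ∷ xs) {Fin.zero}  {Fin.suc j} _   = cong (λ v → lookup v j) (⊕-identityʳ xs)
lookup-⊕-unit (x ∷ _)  {Fin.suc _} {Fin.zero}  _   = ℕ.+-identityʳ x
lookup-⊕-unit (_ ∷ xs) {Fin.suc _} {Fin.suc _} i≢j = lookup-⊕-unit xs (i≢j ∘ cong Fin.suc)

MomentDeterminesValue : ∀ {n} → ℕ → ℕ → (Fin n → ℤ) → Set
MomentDeterminesValue {n} h r b = ∀ {u u′ : Vec ℕ n} → Admissible h r u → Admissible h r u′ →
  moment u ≡ moment u′ → weightedSum u b ≡ weightedSum u′ b

-- w + eᵢ + eⱼ and w + eₖ + eₗ have the same mass and moment, hence the same value.
swap : ∀ {n h r} {b : Fin n → ℤ} → MomentDeterminesValue h r b → (w : Vec ℕ n) → mass w + 2 ≡ h →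
  ∀ {i j k l} → toℕ i + toℕ j ≡ toℕ k + toℕ l →
  r ≤ support (w ⊕ unit i ⊕ unit j) → r ≤ support (w ⊕ unit k ⊕ unit l) → b i ℤ.+ b j ≡ b k ℤ.+ b l
swap {h = h} {b = b} determined w mass≡h {i} {j} {k} {l} level r≤ r≤′ =
  ∙-cancelˡ (weightedSum w b) _ _ (begin
    weightedSum w b ℤ.+ (b i ℤ.+ b j)              ≡⟨ pair-value i j ⟨
    weightedSum (w ⊕ unit i ⊕ unit j) b
      ≡⟨ determined {w ⊕ unit i ⊕ unit j} {w ⊕ unit k ⊕ unit l}
                    (admissible (pair-mass i j) r≤) (admissible (pair-mass k l) r≤′) pair-moment ⟩
    weightedSum (w ⊕ unit k ⊕ unit l) b            ≡⟨ pair-value k l ⟩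
    weightedSum w b ℤ.+ (b k ℤ.+ b l)              ∎)
  where
  open ≡-Reasoning
  pair-mass : ∀ p q → mass (w ⊕ unit p ⊕ unit q) ≡ h
  pair-mass p q = begin
    mass (w ⊕ unit p ⊕ unit q)
      ≡⟨ trans (mass-⊕ (w ⊕ unit p) (unit q)) (cong₂ _+_ (mass-⊕ w (unit p)) (mass-unit q)) ⟩
    mass w + mass (unit p) + 1                ≡⟨ cong (λ m → mass w + m + 1) (mass-unit p) ⟩
    mass w + 1 + 1                            ≡⟨ ℕ.+-assoc (mass w) 1 1 ⟩
    mass w + 2                                ≡⟨ mass≡h ⟩
    h                                         ∎
  pair-moment′ : ∀ p q → moment (w ⊕ unit p ⊕ unit q) ≡ moment w + (toℕ p + toℕ q)
  pair-moment′ p q = begin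
    moment (w ⊕ unit p ⊕ unit q)
      ≡⟨ trans (moment-⊕ (w ⊕ unit p) (unit q)) (cong (_+ _) (moment-⊕ w (unit p))) ⟩
    moment w + moment (unit p) + moment (unit q)  ≡⟨ cong₂ (λ m m′ → moment w + m + m′) (moment-unit p) (moment-unit q) ⟩
    moment w + toℕ p + toℕ q                      ≡⟨ ℕ.+-assoc (moment w) (toℕ p) (toℕ q) ⟩
    moment w + (toℕ p + toℕ q)                    ∎
  pair-moment : moment (w ⊕ unit i ⊕ unit j) ≡ moment (w ⊕ unit k ⊕ unit l)
  pair-moment = trans (pair-moment′ i j) (trans (cong (_+_ (moment w)) level) (sym (pair-moment′ k l)))
  pair-value : ∀ p q → weightedSum (w ⊕ unit p ⊕ unit q) b ≡ weightedSum w b ℤ.+ (b p ℤ.+ b q)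
  pair-value p q = begin
    weightedSum (w ⊕ unit p ⊕ unit q) b
      ≡⟨ trans (weightedSum-⊕ (w ⊕ unit p) (unit q) b) (cong (ℤ._+ _) (weightedSum-⊕ w (unit p) b)) ⟩
    weightedSum w b ℤ.+ weightedSum (unit p) b ℤ.+ weightedSum (unit q) b
      ≡⟨ cong₂ (λ v v′ → weightedSum w b ℤ.+ v ℤ.+ v′) (weightedSum-unit p b) (weightedSum-unit q b) ⟩
    weightedSum w b ℤ.+ b p ℤ.+ b q
      ≡⟨ ℤ.+-assoc (weightedSum w b) (b p) (b q) ⟩
    weightedSum w b ℤ.+ (b p ℤ.+ b q) ∎

∣p∪q∣≤∣p∣+∣q∣ : ∀ {n} (p q : Subset n) → ∣ p ∪ q ∣ ≤ ∣ p ∣ + ∣ q ∣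
∣p∪q∣≤∣p∣+∣q∣ []            []            = z≤n
∣p∪q∣≤∣p∣+∣q∣ (outside ∷ p) (outside ∷ q) = ∣p∪q∣≤∣p∣+∣q∣ p q
∣p∪q∣≤∣p∣+∣q∣ (outside ∷ p) (inside  ∷ q) =
  subst (suc ∣ p ∪ q ∣ ≤_) (sym (ℕ.+-suc ∣ p ∣ ∣ q ∣)) (s≤s (∣p∪q∣≤∣p∣+∣q∣ p q))
∣p∪q∣≤∣p∣+∣q∣ (inside  ∷ p) (x       ∷ q) =
  s≤s (ℕ.≤-trans (∣p∪q∣≤∣p∣+∣q∣ p q) (ℕ.+-monoʳ-≤ ∣ p ∣ (∣p∣≤∣x∷p∣ x q)))

fill : ∀ {n} s (F : Subset n) → s + ∣ F ∣ ≤ n →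
  ∃[ w ] mass w ≡ s × support w ≡ s × (∀ {i} → i ∈ₛ F → lookup w i ≡ 0)
fill {n} zero F _ = replicate n 0 , Zeros-mass (replicate-Zeros n) , Zeros-support (replicate-Zeros n) , λ {i} _ → lookup-replicate i 0
fill {suc n} (suc s) (inside ∷ F) s+∣F∣<n
  with w , mass≡ , support≡ , vanish ← fill (suc s) F (ℕ.s≤s⁻¹ (subst (_≤ suc n) (ℕ.+-suc (suc s) ∣ F ∣) s+∣F∣<n)) =
  0 ∷ w , mass≡ , support≡ , λ { here → refl ; (there i∈F) → vanish i∈F }
fill (suc s) (outside ∷ F) (s≤s s+∣F∣≤n) with w , mass≡ , support≡ , vanish ← fill s F s+∣F∣≤n =
  1 ∷ w , cong suc mass≡ , cong suc support≡ , λ { (there i∈F) → vanish i∈F }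

∣⁅x⁆∪p∣≤1+∣p∣ : ∀ {n} (x : Fin n) p → ∣ ⁅ x ⁆ ∪ p ∣ ≤ suc ∣ p ∣
∣⁅x⁆∪p∣≤1+∣p∣ x p = subst (λ c → ∣ ⁅ x ⁆ ∪ p ∣ ≤ c + ∣ p ∣) (∣⁅x⁆∣≡1 x) (∣p∪q∣≤∣p∣+∣q∣ ⁅ x ⁆ p)

∣⁅x⁆∪⁅y⁆∣≤2 : ∀ {n} (x y : Fin n) → ∣ ⁅ x ⁆ ∪ ⁅ y ⁆ ∣ ≤ 2
∣⁅x⁆∪⁅y⁆∣≤2 x y = ℕ.≤-trans (∣⁅x⁆∪p∣≤1+∣p∣ x ⁅ y ⁆) (ℕ.≤-reflexive (cong suc (∣⁅x⁆∣≡1 y)))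

∣⁅x⁆∪⁅y⁆∪⁅z⁆∪⁅t⁆∣≤4 : ∀ {n} (x y z t : Fin n) → ∣ ⁅ x ⁆ ∪ ⁅ y ⁆ ∪ ⁅ z ⁆ ∪ ⁅ t ⁆ ∣ ≤ 4
∣⁅x⁆∪⁅y⁆∪⁅z⁆∪⁅t⁆∣≤4 x y z t =
  ℕ.≤-trans (∣⁅x⁆∪p∣≤1+∣p∣ x _) (s≤s (ℕ.≤-trans (∣⁅x⁆∪p∣≤1+∣p∣ y _) (s≤s (∣⁅x⁆∪⁅y⁆∣≤2 z t))))

support-⊕-fresh-pair : ∀ {n} (w : Vec ℕ n) {i j} → i ≢ j → lookup w i ≡ 0 → lookup w j ≡ 0 →
  support (w ⊕ unit i ⊕ unit j) ≡ suc (suc (support w))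
support-⊕-fresh-pair w {i} {j} i≢j wᵢ≡0 wⱼ≡0 =
  trans (support-⊕-unit (w ⊕ unit i) j (trans (lookup-⊕-unit w i≢j) wⱼ≡0)) (cong suc (support-⊕-unit w i wᵢ≡0))

swap-with-spare-mass : ∀ {n h s} {b : Fin (suc n) → ℤ} → MomentDeterminesValue h (suc s) b → s ≤ n → suc s + 2 ≤ h →
  ∀ {i j k l} → toℕ i + toℕ j ≡ toℕ k + toℕ l → b i ℤ.+ b j ≡ b k ℤ.+ b l
swap-with-spare-mass {h = h} {s} determined s≤n r+2≤h {i} {j} {k} {l} level
  with w , admissible mass≡ r≤s , _ ← bottom-vector s (h ∸ 2) s≤n (ℕ.m+n≤o⇒m≤o∸n (suc s) r+2≤h) =
  swap determined w (trans (cong (_+ 2) mass≡) (ℕ.m∸n+n≡m (ℕ.m+n≤o⇒n≤o (suc s) r+2≤h))) level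
       (ℕ.≤-trans r≤s (ℕ.≤-trans (support-⊕ˡ w (unit i)) (support-⊕ˡ (w ⊕ unit i) (unit j))))
       (ℕ.≤-trans r≤s (ℕ.≤-trans (support-⊕ˡ w (unit k)) (support-⊕ˡ (w ⊕ unit k) (unit l))))

swap-with-one-fresh : ∀ {n s} {b : Fin n → ℤ} → MomentDeterminesValue (2 + s) (suc s) b → s + 2 ≤ n →
  ∀ {i j k l} → toℕ i + toℕ j ≡ toℕ k + toℕ l → b i ℤ.+ b j ≡ b k ℤ.+ b l
swap-with-one-fresh {s = s} determined s+2≤n {i} {j} {k} {l} level
  with w , mass≡ , support≡ , vanish ← fill s (⁅ i ⁆ ∪ ⁅ k ⁆) (ℕ.≤-trans (ℕ.+-monoʳ-≤ s (∣⁅x⁆∪⁅y⁆∣≤2 i k)) s+2≤n) =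
  swap determined w (trans (cong (_+ 2) mass≡) (ℕ.+-comm s 2)) level
       (r≤ i j (p⊆p∪q ⁅ k ⁆ (x∈⁅x⁆ i))) (r≤ k l (q⊆p∪q ⁅ i ⁆ ⁅ k ⁆ (x∈⁅x⁆ k)))
  where
  r≤ : ∀ p q → p ∈ₛ ⁅ i ⁆ ∪ ⁅ k ⁆ → suc s ≤ support (w ⊕ unit p ⊕ unit q)
  r≤ p q p∈F = ℕ.≤-trans (ℕ.≤-reflexive (sym (trans (support-⊕-unit w p (vanish p∈F)) (cong suc support≡))))
                         (support-⊕ˡ (w ⊕ unit p) (unit q))

swap-with-two-fresh : ∀ {n s} {b : Fin n → ℤ} → MomentDeterminesValue (2 + s) (2 + s) b → 2 + s + 2 ≤ n →
  ∀ {i j k l} → i ≢ j → k ≢ l → toℕ i + toℕ j ≡ toℕ k + toℕ l → b i ℤ.+ b j ≡ b k ℤ.+ b l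
swap-with-two-fresh {n} {s} determined r+2≤n {i} {j} {k} {l} i≢j k≢l level
  with w , mass≡ , support≡ , vanish ← fill s (⁅ i ⁆ ∪ ⁅ j ⁆ ∪ ⁅ k ⁆ ∪ ⁅ l ⁆)
         (ℕ.≤-trans (ℕ.+-monoʳ-≤ s (∣⁅x⁆∪⁅y⁆∪⁅z⁆∪⁅t⁆∣≤4 i j k l))
                    (subst (_≤ n) (trans (ℕ.+-comm (2 + s) 2) (ℕ.+-comm 4 s)) r+2≤n)) =
  swap determined w (trans (cong (_+ 2) mass≡) (ℕ.+-comm s 2)) level
       (r≤ i≢j (p⊆p∪q _ (x∈⁅x⁆ i)) (q⊆p∪q ⁅ i ⁆ _ (p⊆p∪q _ (x∈⁅x⁆ j))))
       (r≤ k≢l (q⊆p∪q ⁅ i ⁆ _ (q⊆p∪q ⁅ j ⁆ _ (p⊆p∪q _ (x∈⁅x⁆ k))))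
               (q⊆p∪q ⁅ i ⁆ _ (q⊆p∪q ⁅ j ⁆ _ (q⊆p∪q ⁅ k ⁆ _ (x∈⁅x⁆ l)))))
  where
  F : Subset n
  F = ⁅ i ⁆ ∪ ⁅ j ⁆ ∪ ⁅ k ⁆ ∪ ⁅ l ⁆
  r≤ : ∀ {p q} → p ≢ q → p ∈ₛ F → q ∈ₛ F → 2 + s ≤ support (w ⊕ unit p ⊕ unit q)
  r≤ p≢q p∈F q∈F = ℕ.≤-reflexive (sym
    (trans (support-⊕-fresh-pair w p≢q (vanish p∈F) (vanish q∈F)) (cong (suc ∘ suc) support≡)))

ConstantGaps : ∀ {m} → (Fin (2 + m) → ℤ) → Set
ConstantGaps b = ∀ i → b 0F ℤ.+ b (Fin.suc i) ≡ b 1F ℤ.+ b (inject₁ i)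

gap-level : ∀ {m} (i : Fin (suc m)) → toℕ {2 + m} 0F + toℕ (Fin.suc i) ≡ toℕ {2 + m} 1F + toℕ (inject₁ i)
gap-level i = cong suc (sym (toℕ-inject₁ i))

gaps-with-two-fresh : ∀ {m s} {b : Fin (5 + m) → ℤ} → MomentDeterminesValue (2 + s) (2 + s) b →
  2 + s + 2 ≤ 5 + m → ConstantGaps b
gaps-with-two-fresh {b = b} determined _ 0F = ℤ.+-comm (b 0F) (b 1F)
-- With h = r both added units need fresh positions, so b₀ + b₂ = b₁ + b₁ is not itself a swap;
-- it is the difference of the swaps (0, 4) ~ (1, 3) and (1, 4) ~ (2, 3).
gaps-with-two-fresh {m} {b = b} determined r+2≤n 1F = ∙-cancelʳ (b 1F ℤ.+ b 4F) _ _ (begin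
  (b 0F ℤ.+ b 2F) ℤ.+ (b 1F ℤ.+ b 4F)   ≡⟨ interchange (b 0F) (b 2F) (b 1F) (b 4F) ⟩
  (b 0F ℤ.+ b 4F) ℤ.+ (b 1F ℤ.+ b 2F)   ≡⟨ cong (ℤ._+ (b 1F ℤ.+ b 2F)) (fresh-swap (λ ()) (λ ()) refl) ⟩
  (b 1F ℤ.+ b 3F) ℤ.+ (b 1F ℤ.+ b 2F)   ≡⟨ interchange′ (b 1F) (b 3F) (b 1F) (b 2F) ⟩
  (b 1F ℤ.+ b 1F) ℤ.+ (b 2F ℤ.+ b 3F)   ≡⟨ cong (ℤ._+_ (b 1F ℤ.+ b 1F)) (fresh-swap (λ ()) (λ ()) refl) ⟨
  (b 1F ℤ.+ b 1F) ℤ.+ (b 1F ℤ.+ b 4F)   ∎)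
  where
  open ≡-Reasoning
  open ℤ-Solver
  fresh-swap : ∀ {i j k l : Fin (5 + m)} → i ≢ j → k ≢ l → toℕ i + toℕ j ≡ toℕ k + toℕ l →
    b i ℤ.+ b j ≡ b k ℤ.+ b l
  fresh-swap = swap-with-two-fresh determined r+2≤n
  interchange : ∀ w x y z → (w ℤ.+ x) ℤ.+ (y ℤ.+ z) ≡ (w ℤ.+ z) ℤ.+ (y ℤ.+ x)
  interchange′ : ∀ w x y z → (w ℤ.+ x) ℤ.+ (y ℤ.+ z) ≡ (w ℤ.+ y) ℤ.+ (z ℤ.+ x)
  interchange  = solve 4 (λ w x y z → (w :+ x) :+ (y :+ z) := (w :+ z) :+ (y :+ x)) refl
  interchange′ = solve 4 (λ w x y z → (w :+ x) :+ (y :+ z) := (w :+ y) :+ (z :+ x)) refl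
gaps-with-two-fresh determined r+2≤n i@(Fin.suc (Fin.suc _)) = swap-with-two-fresh determined r+2≤n (λ ()) (λ ()) (gap-level i)

Progression : ∀ {k} → (Fin k → ℤ) → Set
Progression {k} b = ∃[ c ] ∃[ d ] ∀ (i : Fin k) → b i ≡ c ℤ.+ + toℕ i ℤ.* d

ConstantGaps⇒Progression : ∀ {m} {b : Fin (2 + m) → ℤ} → ConstantGaps b → Progression b
ConstantGaps⇒Progression {b = b} gaps = b 0F , b 1F ℤ.- b 0F , progression b (λ i → step (gaps i))
  where
  open ℤ-Solver
  step : ∀ {x y} → b 0F ℤ.+ x ≡ b 1F ℤ.+ y → x ≡ y ℤ.+ (b 1F ℤ.- b 0F)
  step {x} {y} eq = trans (isolate (b 0F) x) (trans (cong (ℤ._- b 0F) eq) (regroup (b 0F) (b 1F) y))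
    where
    isolate : ∀ B₀ X → X ≡ B₀ ℤ.+ X ℤ.- B₀
    isolate = solve 2 (λ B₀ X → X := B₀ :+ X :- B₀) refl
    regroup : ∀ B₀ B₁ Y → B₁ ℤ.+ Y ℤ.- B₀ ≡ Y ℤ.+ (B₁ ℤ.- B₀)
    regroup = solve 3 (λ B₀ B₁ Y → B₁ :+ Y :- B₀ := Y :+ (B₁ :- B₀)) refl
  progression : ∀ {m} (c : Fin (suc m) → ℤ) {d} → (∀ i → c (Fin.suc i) ≡ c (inject₁ i) ℤ.+ d) →
    ∀ j → c j ≡ c 0F ℤ.+ + toℕ j ℤ.* d
  progression c steps Fin.zero = sym (ℤ.+-identityʳ (c 0F))
  progression {suc m} c {d} steps (Fin.suc j) = begin
    c (Fin.suc j)                          ≡⟨ progression (c ∘ Fin.suc) (steps ∘ Fin.suc) j ⟩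
    c 1F ℤ.+ + toℕ j ℤ.* d                 ≡⟨ cong (ℤ._+ + toℕ j ℤ.* d) (steps 0F) ⟩
    c 0F ℤ.+ d ℤ.+ + toℕ j ℤ.* d           ≡⟨ collect (c 0F) d (+ toℕ j) ⟩
    c 0F ℤ.+ + suc (toℕ j) ℤ.* d           ∎
    where
    open ≡-Reasoning
    collect : ∀ C D J → C ℤ.+ D ℤ.+ J ℤ.* D ≡ C ℤ.+ (+ 1 ℤ.+ J) ℤ.* D
    collect = solve 3 (λ C D J → C :+ D :+ J :* D := C :+ (con (+ 1) :+ J) :* D) refl

Progression⇒IsAP : ∀ {k} (a : Fin k → ℤ) (σ : Permutation k k) → Progression (a ∘ (σ ⟨$⟩ʳ_)) → IsAP a
Progression⇒IsAP a σ (c , d , aσ≡) = c , d , λ y → mk⇔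
  (λ (j , aⱼ≡y) → σ ⟨$⟩ˡ j , trans (sym (aσ≡ _)) (trans (cong a (Perm.inverseʳ σ)) aⱼ≡y))
  (λ (i , progᵢ≡y) → σ ⟨$⟩ʳ i , trans (aσ≡ i) progᵢ≡y)

RigidCase : ℕ → ℕ → ℕ → Set
RigidCase k r h = (r + 2 ≤ h × 2 ≤ k) ⊎ ((h ≡ r ⊎ h ≡ suc r) × 5 ≤ k × 2 ≤ r × r + 2 ≤ k)

RigidCase⇒Progression : ∀ {n s h} {b : Fin (suc n) → ℤ} → MomentDeterminesValue h (suc s) b → suc s ≤ suc n →
  RigidCase (suc n) (suc s) h → Progression b
RigidCase⇒Progression {suc m} determined (s≤s s≤n) (inj₁ (r+2≤h , _)) =
  ConstantGaps⇒Progression (swap-with-spare-mass determined s≤n r+2≤h ∘ gap-level)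
RigidCase⇒Progression {suc m} determined _ (inj₂ (inj₂ refl , _ , _ , r+2≤k)) =
  ConstantGaps⇒Progression (swap-with-one-fresh determined (ℕ.≤-trans (ℕ.n≤1+n _) r+2≤k) ∘ gap-level)
RigidCase⇒Progression {suc (suc (suc (suc m)))} {suc s} determined _ (inj₂ (inj₁ refl , _ , _ , r+2≤k)) =
  ConstantGaps⇒Progression (gaps-with-two-fresh determined r+2≤k)
RigidCase⇒Progression {zero} _ _ (inj₁ (_ , s≤s ()))
RigidCase⇒Progression {zero} _ _ (inj₂ (_ , s≤s () , _))
RigidCase⇒Progression {_} {zero} _ _ (inj₂ (inj₁ refl , _ , s≤s () , _))
RigidCase⇒Progression {1} _ _ (inj₂ (_ , s≤s (s≤s ()) , _))
RigidCase⇒Progression {2} _ _ (inj₂ (_ , s≤s (s≤s (s≤s ())) , _))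
RigidCase⇒Progression {3} _ _ (inj₂ (_ , s≤s (s≤s (s≤s (s≤s ()))) , _))

module _ {n} (a : Fin (suc n) → ℤ) (σ : Permutation (suc n) (suc n))
         (a∘σ↑ : (a ∘ (σ ⟨$⟩ʳ_)) Preserves Fin._<_ ⟶ ℤ._<_) {h s : ℕ} where

  open Chains a∘σ↑ (s≤s z≤n) (restrictedSumset h (suc s) a) (∈-restrictedSumset-permute a σ)

  sumsetSize-lower-bound : s ≤ n → suc s ≤ h → suc (h * n) ≤ sumsetSize h (suc s) a + suc s * s
  sumsetSize-lower-bound s≤n r≤h with _ , adm , moment≡ ← bottom-vector s h s≤n r≤h =
    subst (λ y → suc (h * n) ≤ sumsetSize h (suc s) a + y) (triangle-double s) (chain-across-levels adm moment≡)

  sumsetSize-minimal⇒MomentDeterminesValue : sumsetSize h (suc s) a + suc s * s ≤ suc (h * n) →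
    MomentDeterminesValue h (suc s) (a ∘ (σ ⟨$⟩ʳ_))
  sumsetSize-minimal⇒MomentDeterminesValue minimal adm adm′ level = ℤ.≤-antisym
    (ℤ.≮⇒≥ (too-long ∘ split-level adm′ adm (sym level)))
    (ℤ.≮⇒≥ (too-long ∘ split-level adm adm′ level))
    where
    too-long : ¬ (suc (suc (h * n)) ≤ sumsetSize h (suc s) a + (triangle (suc s) + triangle (suc s)))
    too-long long = ℕ.<-irrefl refl (ℕ.≤-trans long
      (subst (λ y → sumsetSize h (suc s) a + y ≤ suc (h * n)) (sym (triangle-double s)) minimal))

m∸n+1+n≡1+m : ∀ {m n} → n ≤ m → m ∸ n + 1 + n ≡ suc m
m∸n+1+n≡1+m {m} {n} n≤m = begin
  m ∸ n + 1 + n     ≡⟨ ℕ.+-assoc (m ∸ n) 1 n ⟩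
  m ∸ n + suc n     ≡⟨ ℕ.+-suc (m ∸ n) n ⟩
  suc (m ∸ n + n)   ≡⟨ cong suc (ℕ.m∸n+n≡m n≤m) ⟩
  suc m             ∎
  where open ≡-Reasoning

theorem3p5 : (k r : ℕ) → 1 ≤ r → r ≤ k →
    (h : ℕ) → r ≤ h → 2 ≤ h →
    (a : Fin k → ℤ) → Injective _≡_ _≡_ a →
    (h * (k ∸ 1) ∸ r * (r ∸ 1) + 1 ≤ sumsetSize h r a)
    × (sumsetSize h r a ≡ h * (k ∸ 1) ∸ r * (r ∸ 1) + 1 →
       ((r + 2 ≤ h × 2 ≤ k) ⊎ ((h ≡ r ⊎ h ≡ suc r) × 5 ≤ k × 2 ≤ r × r + 2 ≤ k)) →
       IsAP a)
theorem3p5 zero    _       1≤r r≤k _ _ _ _ _ = contradiction (ℕ.≤-trans 1≤r r≤k) λ ()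
theorem3p5 (suc n) zero    ()
theorem3p5 (suc n) (suc s) _   r≤k h r≤h _ a a-inj with σ , a∘σ↑ ← increasing-rearrangement a a-inj =
  lower-bound , λ size≡ rigid → Progression⇒IsAP a σ (RigidCase⇒Progression (determined size≡) r≤k rigid)
  where
  Y≤H : suc s * s ≤ h * n
  Y≤H = ℕ.*-mono-≤ r≤h (ℕ.s≤s⁻¹ r≤k)
  lower-bound : h * n ∸ suc s * s + 1 ≤ sumsetSize h (suc s) a
  lower-bound = ℕ.+-cancelʳ-≤ (suc s * s) _ _
    (subst (_≤ sumsetSize h (suc s) a + suc s * s) (sym (m∸n+1+n≡1+m Y≤H))
           (sumsetSize-lower-bound a σ a∘σ↑ (ℕ.s≤s⁻¹ r≤k) r≤h))
  determined : sumsetSize h (suc s) a ≡ h * n ∸ suc s * s + 1 → MomentDeterminesValue h (suc s) (a ∘ (σ ⟨$⟩ʳ_))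
  determined size≡ = sumsetSize-minimal⇒MomentDeterminesValue a σ a∘σ↑
    (ℕ.≤-reflexive (trans (cong (_+ suc s * s) size≡) (m∸n+1+n≡1+m Y≤H)))
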